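{- Let $U$ be a set of users, $R$ a set of resources, $w_c$ a user-independent weighted constraint, and $A_1,A_2\subseteq U\times R$ two authorization relations such that $\operatorname{usr}_{A_1}(T)=\operatorname{usr}_{A_2}(T)$ for all $T\subseteq R$. Then $w_c(A_1)=w_c(A_2)$.
   Context: For $A\subseteq U\times R$ and $u\in U$, $A(u)=\{r\in R:(u,r)\in A\}$. The user profile of $A$ is the function $\operatorname{usr}_A:2^R\to\mathbb{N}$, $\operatorname{usr}_A(T)=|\{u\in U: A(u)=T\}|$. A weighted constraint is a function $w_c:2^{U\times R}\to\mathbb{N}$; it is user-independent if $w_c(\sigma(A))=w_c(A)$ for every $A$ and every permutation $\sigma$ of $U$, where $\sigma(A)=\{(\sigma(u),r):(u,r)\in A\}$. -}

module Defs where

open import Data.Nat using (ℕ)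
open import Data.Fin using (Fin)
open import Data.Fin.Subset using (Subset)
open import Data.Vec.Properties using (≡-dec)
open import Data.Bool.Properties renaming (_≟_ to _≟ᵇ_) using ()
open import Data.Fin.Permutation using (Permutation′; _⟨$⟩ˡ_)
open import Data.Vec using (Vec; lookup; tabulate; count)
open import Relation.Binary.PropositionalEquality using (_≡_)

-- An authorization relation A ⊆ U × R is represented by its characteristic
-- data: for each user u, the subset A(u) = { r | (u , r) ∈ A } ⊆ R.
-- (Vec (Subset m) n is in bijection with the subsets of Fin n × Fin m.)
AuthRel : ℕ → ℕ → Set
AuthRel n m = Vec (Subset m) n

_⟨_⟩ : ∀ {n m} → AuthRel n m → Fin n → Subset m
A ⟨ u ⟩ = lookup A u

usr : ∀ {n m} → AuthRel n m → Subset m → ℕ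
usr A T = count (λ S → ≡-dec _≟ᵇ_ S T) A

-- σ(A) = { (σ u , r) : (u , r) ∈ A }, i.e. σ(A)(v) = A(σ⁻¹ v)
permute : ∀ {n m} → Permutation′ n → AuthRel n m → AuthRel n m
permute σ A = tabulate (λ v → lookup A (σ ⟨$⟩ˡ v))

WeightedConstraint : ℕ → ℕ → Set
WeightedConstraint n m = AuthRel n m → ℕ

UserIndependent : ∀ {n m} → WeightedConstraint n m → Set
UserIndependent {n} {m} w = ∀ (σ : Permutation′ n) (A : AuthRel n m) → w (permute σ A) ≡ w A

{-# OPTIONS --safe #-}
-- The profile of A₂ contains the first row x
-- of A₁, say at user i; a permutation moving i to the front rewrites A₂ as x
-- followed by A₂ with row i removed, without changing w. Removing x from both
-- relations keeps the profiles equal, and w (x ∷ _) is again user-independent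
-- (use the permutations fixing the first user), so the induction hypothesis
-- applies to the remaining rows.
module Submission where

open import Defs
open import Data.Nat using (ℕ; suc)
open import Data.Nat.Properties using (suc-injective)
open import Data.Fin using (Fin; punchIn) renaming (zero to fz; suc to fs)
open import Data.Fin.Subset using (Subset)
open import Data.Fin.Permutation using (Permutation′; flip; insert; id; lift₀)
open import Data.Vec using (Vec; []; _∷_; lookup; tabulate; count; removeAt)
open import Data.Vec.Properties using (≡-dec; tabulate∘lookup)
open import Data.Bool using (true; false)
open import Data.Bool.Properties renaming (_≟_ to _≟ᵇ_) using ()
open import Data.Product using (∃; _,_)
open import Function using (_∘_)
open import Relation.Nullary using (yes; no; does; contradiction)
open import Relation.Unary using (Pred; Decidable)
open import Relation.Binary.PropositionalEquality

module _ {a p} {A : Set a} {P : Pred A p} (P? : Decidable P) where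

  count-∷-≢0 : ∀ {n} {x} (xs : Vec A n) → P x → count P? (x ∷ xs) ≢ 0
  count-∷-≢0 {x = x} xs px with P? x
  ... | yes _  = λ ()
  ... | no ¬px = contradiction px ¬px

  count-∷-cancel : ∀ {n} x (xs ys : Vec A n) →
                   count P? (x ∷ xs) ≡ count P? (x ∷ ys) → count P? xs ≡ count P? ys
  count-∷-cancel x xs ys eq with does (P? x)
  ... | true  = suc-injective eq
  ... | false = eq

  count-∷-cong : ∀ {n} x (xs ys : Vec A n) →
                 count P? xs ≡ count P? ys → count P? (x ∷ xs) ≡ count P? (x ∷ ys)
  count-∷-cong x xs ys eq with does (P? x)
  ... | true  = cong suc eq
  ... | false = eq

  count-swap : ∀ {n} x y (xs : Vec A n) → count P? (x ∷ y ∷ xs) ≡ count P? (y ∷ x ∷ xs)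
  count-swap x y xs with does (P? x) | does (P? y)
  ... | true  | true  = refl
  ... | true  | false = refl
  ... | false | true  = refl
  ... | false | false = refl

  count-removeAt : ∀ {n} (xs : Vec A (suc n)) (i : Fin (suc n)) →
                   count P? (lookup xs i ∷ removeAt xs i) ≡ count P? xs
  count-removeAt (x ∷ xs)         fz     = refl
  count-removeAt (x ∷ xs@(_ ∷ _)) (fs i) =
    trans (count-swap (lookup xs i) x (removeAt xs i))
          (count-∷-cong x (lookup xs i ∷ removeAt xs i) xs (count-removeAt xs i))

  count≢0⇒∃lookup : ∀ {n} (xs : Vec A n) → count P? xs ≢ 0 → ∃ λ i → P (lookup xs i)
  count≢0⇒∃lookup []       count≢0 = contradiction refl count≢0
  count≢0⇒∃lookup (x ∷ xs) count≢0 with P? x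
  ... | yes px = fz , px
  ... | no _   with count≢0⇒∃lookup xs count≢0
  ...   | i , pxᵢ = fs i , pxᵢ

tabulate-lookup-punchIn : ∀ {a} {A : Set a} {n} (xs : Vec A (suc n)) (i : Fin (suc n)) →
                          tabulate (lookup xs ∘ punchIn i) ≡ removeAt xs i
tabulate-lookup-punchIn (x ∷ xs)     fz     = tabulate∘lookup xs
tabulate-lookup-punchIn (x ∷ y ∷ xs) (fs i) = cong (x ∷_) (tabulate-lookup-punchIn (y ∷ xs) i)

toFront : ∀ {n} → Fin (suc n) → Permutation′ (suc n)
toFront i = flip (insert fz i id)

permute-toFront : ∀ {n m} (i : Fin (suc n)) (A : AuthRel (suc n) m) →
                  permute (toFront i) A ≡ A ⟨ i ⟩ ∷ removeAt A i
permute-toFront i A = cong (A ⟨ i ⟩ ∷_) (tabulate-lookup-punchIn A i)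

permute-lift₀ : ∀ {n m} (σ : Permutation′ n) (x : Subset m) (A : AuthRel n m) →
                permute (lift₀ σ) (x ∷ A) ≡ x ∷ permute σ A
permute-lift₀ σ x A = refl

UserIndependent-∷ : ∀ {n m} {w : WeightedConstraint (suc n) m} (x : Subset m) →
                    UserIndependent w → UserIndependent (w ∘ (x ∷_))
UserIndependent-∷ {w = w} x ind σ A =
  trans (cong w (sym (permute-lift₀ σ x A))) (ind (lift₀ σ) (x ∷ A))

usr-∷-≢0 : ∀ {n m} (x : Subset m) (A : AuthRel n m) → usr (x ∷ A) x ≢ 0
usr-∷-≢0 x A = count-∷-≢0 (λ S → ≡-dec _≟ᵇ_ S x) A refl

usr-removeAt : ∀ {n m} {x : Subset m} (A₁ : AuthRel n m) (A₂ : AuthRel (suc n) m) (i : Fin (suc n)) →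
               A₂ ⟨ i ⟩ ≡ x → (∀ T → usr (x ∷ A₁) T ≡ usr A₂ T) →
               ∀ T → usr A₁ T ≡ usr (removeAt A₂ i) T
usr-removeAt {x = x} A₁ A₂ i A₂ᵢ≡x same T =
  count-∷-cancel P? x A₁ (removeAt A₂ i)
    (trans (same T) (trans (sym (count-removeAt P? A₂ i))
                           (cong (λ y → count P? (y ∷ removeAt A₂ i)) A₂ᵢ≡x)))
  where P? = λ S → ≡-dec _≟ᵇ_ S T

lemma4 : ∀ {n m : ℕ} (w : WeightedConstraint n m) → UserIndependent w →
         (A₁ A₂ : AuthRel n m) → (∀ (T : Subset m) → usr A₁ T ≡ usr A₂ T) →
         w A₁ ≡ w A₂
lemma4 w ind [] [] same = refl
lemma4 w ind (x ∷ A₁) A₂ same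
  with count≢0⇒∃lookup (λ S → ≡-dec _≟ᵇ_ S x) A₂
         (λ usr≡0 → usr-∷-≢0 x A₁ (trans (same x) usr≡0))
... | i , A₂ᵢ≡x = begin
  w (x ∷ A₁)                 ≡⟨ lemma4 (w ∘ (x ∷_)) (UserIndependent-∷ x ind) A₁ (removeAt A₂ i)
                                       (usr-removeAt A₁ A₂ i A₂ᵢ≡x same) ⟩
  w (x ∷ removeAt A₂ i)      ≡⟨ cong (λ y → w (y ∷ removeAt A₂ i)) A₂ᵢ≡x ⟨
  w (A₂ ⟨ i ⟩ ∷ removeAt A₂ i) ≡⟨ cong w (permute-toFront i A₂) ⟨
  w (permute (toFront i) A₂) ≡⟨ ind (toFront i) A₂ ⟩
  w A₂                       ∎
  where open ≡-Reasoning
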